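{- Let $m\ge1$ and let $\beta_0,\dots,\beta_{m-1}$ be positive reals. Consider the problem of maximizing \[h(q)=\frac{\sum_{k=1}^m k\,q_k}{\sum_{k=1}^m q_k}\] over $q=(q_1,\dots,q_m)$ with $q_k\ge0$, subject to $q_{k+1}\le\beta_kq_k$ for $k=1,\dots,m-1$ and $q_1=\beta_0$. Then in every optimal solution, $q_k=\prod_{j=0}^{k-1}\beta_j$ for all $k=1,\dots,m$. -}

module Defs where

open import Level using (Level; _⊔_) renaming (suc to lsuc)
open import Data.Nat using (ℕ; zero; suc)
open import Data.Fin using (Fin; zero; suc; toℕ; inject₁; inject≤)
open import Data.Fin.Properties using (toℕ<n)
open import Data.Product using (_×_)
open import Relation.Nullary using (¬_)
open import Relation.Binary using (Rel; IsTotalOrder)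
open import Algebra.Bundles using (CommutativeRing)

-- An ordered field (e.g. ℝ): a commutative ring with a total order
-- compatible with + and *, 0 ≠ 1, and multiplicative inverses of
-- nonzero elements (x ⁻¹ is an arbitrary value when x ≈ 0).
record OrderedField (c ℓ : Level) : Set (lsuc (c ⊔ ℓ)) where
  field
    commutativeRing : CommutativeRing c ℓ
  open CommutativeRing commutativeRing public hiding (zero)
  infix 4 _≤_
  infix 8 _⁻¹
  field
    _≤_          : Rel Carrier ℓ
    isTotalOrder : IsTotalOrder _≈_ _≤_
    +-monoˡ-≤    : ∀ {x y} z → x ≤ y → x + z ≤ y + z
    *-nonneg     : ∀ {x y} → 0# ≤ x → 0# ≤ y → 0# ≤ x * y
    0≉1          : ¬ (0# ≈ 1#)
    _⁻¹          : Carrier → Carrier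
    ⁻¹-inverse   : ∀ x → ¬ (x ≈ 0#) → x * x ⁻¹ ≈ 1#

  infix 4 _<_
  _<_ : Rel Carrier ℓ
  x < y = x ≤ y × ¬ (x ≈ y)

  infixl 7 _/_
  _/_ : Carrier → Carrier → Carrier
  x / y = x * y ⁻¹

  fromℕ : ℕ → Carrier
  fromℕ zero    = 0#
  fromℕ (suc n) = 1# + fromℕ n

  ∑ : ∀ {n} → (Fin n → Carrier) → Carrier
  ∑ {zero}  f = 0#
  ∑ {suc n} f = f zero + ∑ (λ i → f (suc i))

  ∏ : ∀ {n} → (Fin n → Carrier) → Carrier
  ∏ {zero}  f = 1#
  ∏ {suc n} f = f zero * ∏ (λ i → f (suc i))

  -- Vectors q = (q_1,…,q_m), m = suc n, stored 0-based: q i = q_{i+1};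
  -- β i = β_i for i = 0,…,m-1.

  h : ∀ {n} → (Fin (suc n) → Carrier) → Carrier
  h q = ∑ (λ i → fromℕ (suc (toℕ i)) * q i) / ∑ q

  Feasible : ∀ {n} → (β q : Fin (suc n) → Carrier) → Set ℓ
  Feasible {n} β q =
    (∀ i → 0# ≤ q i)
    × (∀ (i : Fin n) → q (suc i) ≤ β (suc i) * q (inject₁ i))
    × (q zero ≈ β zero)

  Optimal : ∀ {n} → (β q : Fin (suc n) → Carrier) → Set (c ⊔ ℓ)
  Optimal β q = Feasible β q × (∀ q′ → Feasible β q′ → h q′ ≤ h q)

  -- ∏_{j=0}^{k-1} β_j for the 0-based index i = k-1, i.e. ∏_{j ≤ i} β j
  prefixProd : ∀ {m} → (Fin m → Carrier) → Fin m → Carrier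
  prefixProd β i = ∏ (λ (j : Fin (suc (toℕ i))) → β (inject≤ j (toℕ<n i)))

{-# OPTIONS --safe #-}
module Submission where

-- The vector p of prefix products is feasible, and every feasible q has
-- q_{k+1}/p_{k+1} ≤ q_k/p_k: compared with p, q shifts weight towards small
-- indices, so h(q) ≤ h(p) by a Chebyshev-type inequality. Proving it by
-- splitting off the first coordinate shows that the cross-multiplied gap
-- between h(p) and h(q) dominates ∑_k k (p_{k+1} q_1 - q_{k+1} p_1), a sum of
-- nonnegative terms. For optimal q the gap vanishes, hence so does every term,
-- and q_1 = p_1 = β_0 gives q = p.

open import Defs
open import Data.Nat using (ℕ; zero; suc)
open import Data.Fin using (Fin; zero; suc; toℕ; inject₁)
open import Data.Product using (_,_; proj₁)
open import Data.Sum using (inj₁; inj₂)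
open import Data.Maybe using (nothing)
open import Function using (_∘_)
open import Relation.Nullary using (¬_)
open import Relation.Binary using (IsTotalOrder; Poset)
import Relation.Binary.PropositionalEquality as ≡
import Relation.Binary.Reasoning.PartialOrder as PartialOrderReasoning
open import Tactic.RingSolver.Core.AlmostCommutativeRing using (fromCommutativeRing)
import Tactic.RingSolver.NonReflective as RingSolver
import Algebra.Properties.Ring as RingProperties
import Algebra.Properties.Group as GroupProperties
import Algebra.Properties.CommutativeSemigroup as CommutativeSemigroupProperties
import Algebra.Properties.Semiring.Sum as SemiringSum

module OrderedFieldLemmas {c ℓ} (F : OrderedField c ℓ) where
  open OrderedField F
  open IsTotalOrder isTotalOrder public using (total; antisym; isPartialOrder)
    renaming (refl to ≤-refl; trans to ≤-trans; reflexive to ≤-reflexive)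
  open RingSolver (fromCommutativeRing commutativeRing (λ _ → nothing)) using (solve; _⊜_; _⊗_)
  open GroupProperties +-group using (//-rightDividesˡ; //-rightDividesʳ)
  open SemiringSum semiring using (sum; sum-cong-≋; ∑-distrib-+; *-distribʳ-sum)

  poset : Poset c ℓ ℓ
  poset = record { isPartialOrder = isPartialOrder }

  open PartialOrderReasoning poset

  +-monoʳ-≤ : ∀ z {x y} → x ≤ y → z + x ≤ z + y
  +-monoʳ-≤ z {x} {y} x≤y = begin
    z + x  ≈⟨ +-comm z x ⟩
    x + z  ≤⟨ +-monoˡ-≤ z x≤y ⟩
    y + z  ≈⟨ +-comm y z ⟩
    z + y  ∎

  +-mono-≤ : ∀ {x y u v} → x ≤ y → u ≤ v → x + u ≤ y + v
  +-mono-≤ {y = y} {u} x≤y u≤v = ≤-trans (+-monoˡ-≤ u x≤y) (+-monoʳ-≤ y u≤v)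

  +-cancelʳ-≤ : ∀ z {x y} → x + z ≤ y + z → x ≤ y
  +-cancelʳ-≤ z {x} {y} le = begin
    x          ≈⟨ //-rightDividesʳ z x ⟨
    x + z - z  ≤⟨ +-monoˡ-≤ (- z) le ⟩
    y + z - z  ≈⟨ //-rightDividesʳ z y ⟩
    y          ∎

  +-cancelˡ-≤ : ∀ z {x y} → z + x ≤ z + y → x ≤ y
  +-cancelˡ-≤ z {x} {y} le =
    +-cancelʳ-≤ z (≤-trans (≤-reflexive (+-comm x z)) (≤-trans le (≤-reflexive (+-comm z y))))

  +-tightˡ : ∀ {x y u v} → x ≤ y → u ≤ v → x + u ≈ y + v → x ≈ y
  +-tightˡ {x} {y} {u} {v} x≤y u≤v eq = antisym x≤y (+-cancelʳ-≤ u (begin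
    y + u  ≤⟨ +-monoʳ-≤ y u≤v ⟩
    y + v  ≈⟨ eq ⟨
    x + u  ∎))

  +-tightʳ : ∀ {x y u v} → x ≤ y → u ≤ v → x + u ≈ y + v → u ≈ v
  +-tightʳ {x} {y} {u} {v} x≤y u≤v eq =
    +-tightˡ u≤v x≤y (trans (+-comm u x) (trans eq (+-comm y v)))

  ≤⇒0≤- : ∀ {x y} → x ≤ y → 0# ≤ y - x
  ≤⇒0≤- {x} {y} x≤y = ≤-trans (≤-reflexive (sym (-‿inverseʳ x))) (+-monoˡ-≤ (- x) x≤y)

  *-monoˡ-≤ : ∀ {k x y} → 0# ≤ k → x ≤ y → k * x ≤ k * y
  *-monoˡ-≤ {k} {x} {y} 0≤k x≤y = begin
    k * x                ≈⟨ +-identityˡ (k * x) ⟨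
    0# + k * x           ≤⟨ +-monoˡ-≤ (k * x) (*-nonneg 0≤k (≤⇒0≤- x≤y)) ⟩
    k * (y - x) + k * x  ≈⟨ distribˡ k (y - x) x ⟨
    k * (y - x + x)      ≈⟨ *-congˡ (//-rightDividesˡ x y) ⟩
    k * y                ∎

  *-monoʳ-≤ : ∀ {k x y} → 0# ≤ k → x ≤ y → x * k ≤ y * k
  *-monoʳ-≤ {k} {x} {y} 0≤k x≤y =
    ≤-trans (≤-reflexive (*-comm x k)) (≤-trans (*-monoˡ-≤ 0≤k x≤y) (≤-reflexive (*-comm k y)))

  *-cancelˡ-≈ : ∀ {k x y} → ¬ (k ≈ 0#) → k * x ≈ k * y → x ≈ y
  *-cancelˡ-≈ {k} {x} {y} k≉0 eq = begin-equality
    x                ≈⟨ *-identityˡ x ⟨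
    1# * x           ≈⟨ *-congʳ k⁻¹k≈1 ⟨
    k ⁻¹ * k * x     ≈⟨ *-assoc (k ⁻¹) k x ⟩
    k ⁻¹ * (k * x)   ≈⟨ *-congˡ eq ⟩
    k ⁻¹ * (k * y)   ≈⟨ *-assoc (k ⁻¹) k y ⟨
    k ⁻¹ * k * y     ≈⟨ *-congʳ k⁻¹k≈1 ⟩
    1# * y           ≈⟨ *-identityˡ y ⟩
    y                ∎
    where
    k⁻¹k≈1 : k ⁻¹ * k ≈ 1#
    k⁻¹k≈1 = trans (*-comm (k ⁻¹) k) (⁻¹-inverse k k≉0)

  *-cancelʳ-≈ : ∀ {k x y} → ¬ (k ≈ 0#) → x * k ≈ y * k → x ≈ y
  *-cancelʳ-≈ {k} {x} {y} k≉0 eq = *-cancelˡ-≈ k≉0 (trans (*-comm k x) (trans eq (*-comm y k)))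

  <⇒≉0 : ∀ {x} → 0# < x → ¬ (x ≈ 0#)
  <⇒≉0 (_ , 0≉x) x≈0 = 0≉x (sym x≈0)

  *-cancelˡ-≤ : ∀ {k x y} → 0# < k → k * x ≤ k * y → x ≤ y
  *-cancelˡ-≤ {k} {x} {y} 0<k kx≤ky with total x y
  ... | inj₁ x≤y = x≤y
  ... | inj₂ y≤x = ≤-reflexive (*-cancelˡ-≈ (<⇒≉0 0<k) (antisym kx≤ky (*-monoˡ-≤ (proj₁ 0<k) y≤x)))

  /≤/⇒*≤* : ∀ {x y s t} → 0# < s → 0# < t → x / s ≤ y / t → x * t ≤ y * s
  /≤/⇒*≤* {x} {y} {s} {t} 0<s 0<t le = begin
    x * t              ≈⟨ cancel x s t (<⇒≉0 0<s) ⟨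
    x / s * (s * t)    ≤⟨ *-monoʳ-≤ (*-nonneg (proj₁ 0<s) (proj₁ 0<t)) le ⟩
    y / t * (s * t)    ≈⟨ *-congˡ (*-comm s t) ⟩
    y / t * (t * s)    ≈⟨ cancel y t s (<⇒≉0 0<t) ⟩
    y * s              ∎
    where
    cancel : ∀ x s t → ¬ (s ≈ 0#) → x / s * (s * t) ≈ x * t
    cancel x s t s≉0 = begin-equality
      x * s ⁻¹ * (s * t)    ≈⟨ solve 4 (λ x s⁻¹ s t → x ⊗ s⁻¹ ⊗ (s ⊗ t) ⊜ x ⊗ t ⊗ (s ⊗ s⁻¹))
                                      refl x (s ⁻¹) s t ⟩
      x * t * (s * s ⁻¹)    ≈⟨ *-congˡ (⁻¹-inverse s s≉0) ⟩
      x * t * 1#            ≈⟨ *-identityʳ (x * t) ⟩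
      x * t                 ∎

  <-respʳ-≈ : ∀ {x y} → 0# < x → x ≈ y → 0# < y
  <-respʳ-≈ (0≤x , 0≉x) x≈y = ≤-trans 0≤x (≤-reflexive x≈y) , λ 0≈y → 0≉x (trans 0≈y (sym x≈y))

  0<1 : 0# < 1#
  0<1 = 0≤1 , 0≉1
    where
    0≤1 : 0# ≤ 1#
    0≤1 with total 0# 1#
    ... | inj₁ 0≤1 = 0≤1
    ... | inj₂ 1≤0 = begin
      0#            ≤⟨ *-nonneg 0≤-1 0≤-1 ⟩
      - 1# * - 1#   ≈⟨ RingProperties.-1*x≈-x ring (- 1#) ⟩
      - - 1#        ≈⟨ RingProperties.-‿involutive ring 1# ⟩
      1#            ∎
      where
      0≤-1 : 0# ≤ - 1#
      0≤-1 = ≤-trans (≤⇒0≤- 1≤0) (≤-reflexive (+-identityˡ (- 1#)))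

  +-pos : ∀ {x y} → 0# < x → 0# ≤ y → 0# < x + y
  +-pos {x} {y} (0≤x , 0≉x) 0≤y = ≤-trans 0≤x x≤x+y , λ 0≈x+y →
      0≉x (antisym 0≤x (≤-trans x≤x+y (≤-reflexive (sym 0≈x+y))))
    where
    x≤x+y : x ≤ x + y
    x≤x+y = ≤-trans (≤-reflexive (sym (+-identityʳ x))) (+-monoʳ-≤ x 0≤y)

  *-pos : ∀ {x y} → 0# < x → 0# < y → 0# < x * y
  *-pos {x} {y} 0<x (0≤y , 0≉y) = *-nonneg (proj₁ 0<x) 0≤y , λ 0≈xy →
    0≉y (*-cancelˡ-≈ (<⇒≉0 0<x) (trans (zeroʳ x) 0≈xy))

  fromℕ-nonneg : ∀ k → 0# ≤ fromℕ k
  fromℕ-pos : ∀ k → 0# < fromℕ (suc k)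
  fromℕ-nonneg zero    = ≤-refl
  fromℕ-nonneg (suc k) = proj₁ (fromℕ-pos k)
  fromℕ-pos k = +-pos 0<1 (fromℕ-nonneg k)

  ∑≡sum : ∀ {n} (f : Fin n → Carrier) → ∑ f ≡.≡ sum f
  ∑≡sum {zero}  f = ≡.refl
  ∑≡sum {suc n} f = ≡.cong (f zero +_) (∑≡sum (f ∘ suc))

  ∑-cong : ∀ {n} {f g : Fin n → Carrier} → (∀ i → f i ≈ g i) → ∑ f ≈ ∑ g
  ∑-cong {f = f} {g} f≈g rewrite ∑≡sum f | ∑≡sum g = sum-cong-≋ f≈g

  ∑-+ : ∀ {n} (f g : Fin n → Carrier) → ∑ (λ i → f i + g i) ≈ ∑ f + ∑ g
  ∑-+ f g rewrite ∑≡sum (λ i → f i + g i) | ∑≡sum f | ∑≡sum g = ∑-distrib-+ f g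

  *-distribʳ-∑ : ∀ {n} x (f : Fin n → Carrier) → ∑ f * x ≈ ∑ (λ i → f i * x)
  *-distribʳ-∑ x f rewrite ∑≡sum f | ∑≡sum (λ i → f i * x) = *-distribʳ-sum x f

  ∑-mono-≤ : ∀ {n} {f g : Fin n → Carrier} → (∀ i → f i ≤ g i) → ∑ f ≤ ∑ g
  ∑-mono-≤ {zero}  f≤g = ≤-refl
  ∑-mono-≤ {suc n} f≤g = +-mono-≤ (f≤g zero) (∑-mono-≤ (f≤g ∘ suc))

  ∑-nonneg : ∀ {n} {f : Fin n → Carrier} → (∀ i → 0# ≤ f i) → 0# ≤ ∑ f
  ∑-nonneg {zero}  0≤f = ≤-refl
  ∑-nonneg {suc n} 0≤f =
    ≤-trans (≤-reflexive (sym (+-identityʳ 0#))) (+-mono-≤ (0≤f zero) (∑-nonneg (0≤f ∘ suc)))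

  ∑-pos : ∀ {n} (f : Fin (suc n) → Carrier) → 0# < f zero → (∀ i → 0# ≤ f (suc i)) → 0# < ∑ f
  ∑-pos f 0<f₀ 0≤f = +-pos 0<f₀ (∑-nonneg 0≤f)

  ∑-≈-pointwise : ∀ {n} {f g : Fin n → Carrier} → (∀ i → f i ≤ g i) → ∑ f ≈ ∑ g → ∀ i → f i ≈ g i
  ∑-≈-pointwise f≤g eq zero    = +-tightˡ (f≤g zero) (∑-mono-≤ (f≤g ∘ suc)) eq
  ∑-≈-pointwise f≤g eq (suc i) =
    ∑-≈-pointwise (f≤g ∘ suc) (+-tightʳ (f≤g zero) (∑-mono-≤ (f≤g ∘ suc)) eq) i

module FirstMoment {c ℓ} (F : OrderedField c ℓ) where
  open OrderedField F
  open OrderedFieldLemmas F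
  open PartialOrderReasoning poset
  open RingSolver (fromCommutativeRing commutativeRing (λ _ → nothing))
    using (solve; _⊜_; _⊕_; _⊗_)
  open CommutativeSemigroupProperties *-commutativeSemigroup using (x∙yz≈yx∙z; x∙yz≈z∙xy; xy∙z≈y∙xz)

  moment : ∀ {n} → (Fin n → Carrier) → Carrier
  moment x = ∑ (λ i → fromℕ (suc (toℕ i)) * x i)

  moment-suc : ∀ {n} (x : Fin (suc n) → Carrier) →
               moment x ≈ x zero + (moment (x ∘ suc) + ∑ (x ∘ suc))
  moment-suc x = +-cong (trans (*-congʳ (+-identityʳ 1#)) (*-identityˡ (x zero))) (begin-equality
    ∑ (λ i → (1# + w i) * x (suc i))      ≈⟨ ∑-cong (λ i → distribʳ (x (suc i)) 1# (w i)) ⟩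
    ∑ (λ i → 1# * x (suc i) + w i * x (suc i))
      ≈⟨ ∑-+ (λ i → 1# * x (suc i)) (λ i → w i * x (suc i)) ⟩
    ∑ (λ i → 1# * x (suc i)) + moment (x ∘ suc)
      ≈⟨ +-comm _ _ ⟩
    moment (x ∘ suc) + ∑ (λ i → 1# * x (suc i))
      ≈⟨ +-congˡ (∑-cong (λ i → *-identityˡ (x (suc i)))) ⟩
    moment (x ∘ suc) + ∑ (x ∘ suc)        ∎)
    where
    w : ∀ {n} → Fin n → Carrier
    w i = fromℕ (suc (toℕ i))

  moment-*ʳ : ∀ {n} (x : Fin n → Carrier) a → moment x * a ≈ moment (λ i → x i * a)
  moment-*ʳ x a =
    trans (*-distribʳ-∑ a (λ i → fromℕ (suc (toℕ i)) * x i)) (∑-cong (λ i → *-assoc _ (x i) a))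

  moment-mono-≤ : ∀ {n} {x y : Fin n → Carrier} → (∀ i → x i ≤ y i) → moment x ≤ moment y
  moment-mono-≤ x≤y = ∑-mono-≤ (λ i → *-monoˡ-≤ (fromℕ-nonneg (suc (toℕ i))) (x≤y i))

  moment-≈-pointwise : ∀ {n} {x y : Fin n → Carrier} →
                       (∀ i → x i ≤ y i) → moment x ≈ moment y → ∀ i → x i ≈ y i
  moment-≈-pointwise x≤y eq i = *-cancelˡ-≈ (<⇒≉0 (fromℕ-pos (toℕ i)))
    (∑-≈-pointwise (λ j → *-monoˡ-≤ (fromℕ-nonneg (suc (toℕ j))) (x≤y j)) eq i)

  cross-split : ∀ {n} (p x : Fin (suc n) → Carrier) →
    moment x * ∑ p + (moment (p ∘ suc) * x zero + moment (p ∘ suc) * ∑ (x ∘ suc)) ≈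
    moment p * ∑ x + (moment (x ∘ suc) * p zero + moment (x ∘ suc) * ∑ (p ∘ suc))
  cross-split p x = begin-equality
    moment x * ∑ p + (Mp * x₀ + Mp * Sx)                ≈⟨ +-congʳ (*-congʳ (moment-suc x)) ⟩
    (x₀ + (Mx + Sx)) * (p₀ + Sp) + (Mp * x₀ + Mp * Sx)  ≈⟨ expand x₀ p₀ Mx Mp Sx Sp ⟩
    (p₀ + (Mp + Sp)) * (x₀ + Sx) + (Mx * p₀ + Mx * Sp)  ≈⟨ +-congʳ (*-congʳ (moment-suc p)) ⟨
    moment p * ∑ x + (Mx * p₀ + Mx * Sp)                ∎
    where
    x₀ p₀ Mx Mp Sx Sp : Carrier
    x₀ = x zero
    p₀ = p zero
    Mx = moment (x ∘ suc)
    Mp = moment (p ∘ suc)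
    Sx = ∑ (x ∘ suc)
    Sp = ∑ (p ∘ suc)
    expand : ∀ x₀ p₀ Mx Mp Sx Sp →
      (x₀ + (Mx + Sx)) * (p₀ + Sp) + (Mp * x₀ + Mp * Sx) ≈
      (p₀ + (Mp + Sp)) * (x₀ + Sx) + (Mx * p₀ + Mx * Sp)
    expand = solve 6 (λ x₀ p₀ Mx Mp Sx Sp →
      ((x₀ ⊕ (Mx ⊕ Sx)) ⊗ (p₀ ⊕ Sp) ⊕ (Mp ⊗ x₀ ⊕ Mp ⊗ Sx)) ⊜
      ((p₀ ⊕ (Mp ⊕ Sp)) ⊗ (x₀ ⊕ Sx) ⊕ (Mx ⊗ p₀ ⊕ Mx ⊗ Sp))) refl

  -- x k / p k is nonincreasing in k, cross-multiplied
  RatioAntitone : ∀ {n} → (p x : Fin (suc n) → Carrier) → Set ℓ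
  RatioAntitone {n} p x = ∀ (i : Fin n) → x (suc i) * p (inject₁ i) ≤ x (inject₁ i) * p (suc i)

  ratio-≤-head : ∀ {n} (p x : Fin (suc n) → Carrier) → (∀ i → 0# < p i) →
                 RatioAntitone p x → ∀ k → x k * p zero ≤ p k * x zero
  ratio-≤-head         p x _     _    zero    = ≤-reflexive (*-comm _ _)
  ratio-≤-head {suc n} p x p-pos anti (suc j) = *-cancelˡ-≤ (p-pos (suc zero)) (begin
    p₁ * (x (suc j) * p₀)   ≈⟨ x∙yz≈yx∙z p₁ (x (suc j)) p₀ ⟩
    x (suc j) * p₁ * p₀     ≤⟨ *-monoʳ-≤ (proj₁ (p-pos zero)) tail-ratio ⟩
    p (suc j) * x₁ * p₀     ≈⟨ *-assoc (p (suc j)) x₁ p₀ ⟩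
    p (suc j) * (x₁ * p₀)   ≤⟨ *-monoˡ-≤ (proj₁ (p-pos (suc j))) (anti zero) ⟩
    p (suc j) * (x₀ * p₁)   ≈⟨ x∙yz≈z∙xy (p (suc j)) x₀ p₁ ⟩
    p₁ * (p (suc j) * x₀)   ∎)
    where
    p₀ p₁ x₀ x₁ : Carrier
    p₀ = p zero
    p₁ = p (suc zero)
    x₀ = x zero
    x₁ = x (suc zero)
    tail-ratio : x (suc j) * p₁ ≤ p (suc j) * x₁
    tail-ratio = ratio-≤-head (p ∘ suc) (x ∘ suc) (p-pos ∘ suc) (anti ∘ suc) j

  moment-head-≤ : ∀ {n} (p x : Fin (suc n) → Carrier) → (∀ i → 0# < p i) → RatioAntitone p x →
                  moment (x ∘ suc) * p zero ≤ moment (p ∘ suc) * x zero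
  moment-head-≤ p x p-pos anti = begin
    moment (x ∘ suc) * p zero            ≈⟨ moment-*ʳ (x ∘ suc) (p zero) ⟩
    moment (λ i → x (suc i) * p zero)    ≤⟨ moment-mono-≤ (ratio-≤-head p x p-pos anti ∘ suc) ⟩
    moment (λ i → p (suc i) * x zero)    ≈⟨ moment-*ʳ (p ∘ suc) (x zero) ⟨
    moment (p ∘ suc) * x zero            ∎

  mutual
    chebyshev : ∀ {n} (p x : Fin (suc n) → Carrier) → (∀ i → 0# < p i) → RatioAntitone p x →
                moment x * ∑ p ≤ moment p * ∑ x
    chebyshev p x p-pos anti = +-cancelʳ-≤ _ (≤-trans (≤-reflexive (cross-split p x))
      (+-monoʳ-≤ (moment p * ∑ x)
        (+-mono-≤ (moment-head-≤ p x p-pos anti) (chebyshev-tail p x p-pos anti))))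

    chebyshev-tail : ∀ {n} (p x : Fin (suc n) → Carrier) → (∀ i → 0# < p i) → RatioAntitone p x →
                     moment (x ∘ suc) * ∑ (p ∘ suc) ≤ moment (p ∘ suc) * ∑ (x ∘ suc)
    chebyshev-tail {zero}  p x _     _    = ≤-refl
    chebyshev-tail {suc n} p x p-pos anti = chebyshev (p ∘ suc) (x ∘ suc) (p-pos ∘ suc) (anti ∘ suc)

  chebyshev-equality : ∀ {n} (p x : Fin (suc n) → Carrier) → (∀ i → 0# < p i) → RatioAntitone p x →
                       moment p * ∑ x ≤ moment x * ∑ p → ∀ k → x k * p zero ≈ p k * x zero
  chebyshev-equality p x p-pos anti _     zero    = *-comm _ _
  chebyshev-equality p x p-pos anti px≤xp (suc i) =
    moment-≈-pointwise (ratio-≤-head p x p-pos anti ∘ suc)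
      (trans (sym (moment-*ʳ (x ∘ suc) (p zero))) (trans heads (moment-*ʳ (p ∘ suc) (x zero)))) i
    where
    head≤ : moment (x ∘ suc) * p zero ≤ moment (p ∘ suc) * x zero
    head≤ = moment-head-≤ p x p-pos anti
    tail≤ : moment (x ∘ suc) * ∑ (p ∘ suc) ≤ moment (p ∘ suc) * ∑ (x ∘ suc)
    tail≤ = chebyshev-tail p x p-pos anti
    heads : moment (x ∘ suc) * p zero ≈ moment (p ∘ suc) * x zero
    heads = +-tightˡ head≤ tail≤ (antisym (+-mono-≤ head≤ tail≤)
      (+-cancelˡ-≤ (moment p * ∑ x)
        (≤-trans (+-monoˡ-≤ _ px≤xp) (≤-reflexive (cross-split p x)))))

  step-≤⇒ratioAntitone : ∀ {n} (b : Fin n → Carrier) (p q : Fin (suc n) → Carrier) →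
    (∀ i → 0# ≤ p i) → (∀ i → p (suc i) ≈ b i * p (inject₁ i)) →
    (∀ i → q (suc i) ≤ b i * q (inject₁ i)) → RatioAntitone p q
  step-≤⇒ratioAntitone b p q p-nonneg p-step q-step i = begin
    q (suc i) * p (inject₁ i)              ≤⟨ *-monoʳ-≤ (p-nonneg (inject₁ i)) (q-step i) ⟩
    b i * q (inject₁ i) * p (inject₁ i)    ≈⟨ xy∙z≈y∙xz (b i) (q (inject₁ i)) (p (inject₁ i)) ⟩
    q (inject₁ i) * (b i * p (inject₁ i))  ≈⟨ *-congˡ (p-step i) ⟨
    q (inject₁ i) * p (suc i)              ∎

module PrefixProduct {c ℓ} (F : OrderedField c ℓ) where
  open OrderedField F
  open OrderedFieldLemmas F using (*-pos; 0<1)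
  open CommutativeSemigroupProperties *-commutativeSemigroup using (x∙yz≈y∙xz)

  prefixProd-step : ∀ {n} (β : Fin (suc n) → Carrier) (i : Fin n) →
                    prefixProd β (suc i) ≈ β (suc i) * prefixProd β (inject₁ i)
  prefixProd-step {suc n} β zero    = x∙yz≈y∙xz (β zero) (β (suc zero)) 1#
  prefixProd-step {suc n} β (suc i) = trans (*-congˡ (prefixProd-step (β ∘ suc) i))
    (x∙yz≈y∙xz (β zero) (β (suc (suc i))) _)

  prefixProd-pos : ∀ {n} (β : Fin (suc n) → Carrier) → (∀ i → 0# < β i) →
                   ∀ i → 0# < prefixProd β i
  prefixProd-pos         β β-pos zero    = *-pos (β-pos zero) 0<1
  prefixProd-pos {suc n} β β-pos (suc i) =
    *-pos (β-pos zero) (prefixProd-pos (β ∘ suc) (β-pos ∘ suc) i)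

lemma10 : ∀ {c ℓ} (F : OrderedField c ℓ) → let open OrderedField F in
    (n : ℕ) (β : Fin (suc n) → Carrier) → (∀ i → 0# < β i) →
    (q : Fin (suc n) → Carrier) → Optimal β q →
    ∀ i → q i ≈ prefixProd β i
lemma10 F n β β-pos q ((q-nonneg , q-step , q₀≈β₀) , q-optimal) i =
  *-cancelʳ-≈ (<⇒≉0 (p-pos zero))
    (trans (chebyshev-equality p q p-pos q-antitone p-not-better i) (*-congˡ (sym p₀≈q₀)))
  where
  open OrderedField F
  open OrderedFieldLemmas F
  open FirstMoment F
  open PrefixProduct F

  p : Fin (suc n) → Carrier
  p = prefixProd β

  p-pos : ∀ j → 0# < p j
  p-pos = prefixProd-pos β β-pos

  p₀≈q₀ : p zero ≈ q zero
  p₀≈q₀ = trans (*-identityʳ (β zero)) (sym q₀≈β₀)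

  p-feasible : Feasible β p
  p-feasible = proj₁ ∘ p-pos , ≤-reflexive ∘ prefixProd-step β , *-identityʳ (β zero)

  q-antitone : RatioAntitone p q
  q-antitone = step-≤⇒ratioAntitone (β ∘ suc) p q (proj₁ ∘ p-pos) (prefixProd-step β) q-step

  p-not-better : moment p * ∑ q ≤ moment q * ∑ p
  p-not-better = /≤/⇒*≤* (∑-pos p (p-pos zero) (proj₁ ∘ p-pos ∘ suc))
                         (∑-pos q (<-respʳ-≈ (p-pos zero) p₀≈q₀) (q-nonneg ∘ suc))
                         (q-optimal p p-feasible)
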